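{- Let $R$ be an integral domain and let $h,y\in R$ be nonzero. Let $a=(a_n)_{n\ge 0}$ be a linear recurrent sequence over $R$ of degree $r$, with characteristic polynomial $$f(t)=t^r+\sum_{i=1}^r(-1)^i\sigma_i t^{r-i}\in R[t],$$ whose zeros (counted with multiplicity, in a field $\mathbb F$ containing $R$ over which $f$ splits) are $\alpha_1,\ldots,\alpha_r$. Then $L^{(h,y)}(a)$ is a linear recurrent sequence of degree $r$ whose characteristic polynomial $g(t)$ has zeros $h\alpha_1+y,\ldots,h\alpha_r+y$. Moreover, writing $$g(t)=t^r+\sum_{i=1}^r(-1)^i\overline{\sigma_i}\,t^{r-i},$$ one has, with the convention $\sigma_0=1$, $$\overline{\sigma_i}=\sum_{k=0}^{i}\binom{r-k}{i-k}h^k y^{i-k}\sigma_k,\qquad i=1,2,\ldots,r.$$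
   Context: For a sequence $a=(a_n)_{n\ge0}$ over $R$ and $h,y\in R$, the generalized Binomial interpolated operator is defined by $L^{(h,y)}(a)=b$ with $b_n=\sum_{i=0}^n\binom{n}{i}h^iy^{n-i}a_i$. A sequence is linear recurrent of degree $r$ with characteristic polynomial $t^r-c_1t^{r-1}-\cdots-c_r$ if $a_{n}=c_1a_{n-1}+\cdots+c_ra_{n-r}$ for all $n\ge r$. The $\sigma_i$ are the elementary symmetric functions of $\alpha_1,\ldots,\alpha_r$, and the $\overline{\sigma_i}$ are those of $h\alpha_1+y,\ldots,h\alpha_r+y$. -}

module Defs where

open import Level using (Level; _⊔_)
open import Data.Nat using (ℕ; zero; suc; _∸_; _≤_)
open import Data.Nat.Combinatorics using (_C_)
open import Data.List using (List; []; _∷_; map; reverse; upTo)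
open import Data.List.Relation.Binary.Pointwise using (Pointwise)
open import Data.Product using (_×_; ∃)
open import Data.Sum using (_⊎_)
open import Relation.Nullary using (¬_)
open import Algebra.Bundles using (CommutativeRing)
open import Algebra.Morphism.Structures using (module RingMorphisms)

module CR {c ℓ : Level} (R : CommutativeRing c ℓ) where
  open CommutativeRing R

  IsIntegralDomain : Set (c ⊔ ℓ)
  IsIntegralDomain = (¬ (1# ≈ 0#)) × (∀ x y → x * y ≈ 0# → (x ≈ 0#) ⊎ (y ≈ 0#))

  record IsField : Set (c ⊔ ℓ) where
    field
      nontrivial : ¬ (1# ≈ 0#)
      inverse    : ∀ x → ¬ (x ≈ 0#) → ∃ λ x⁻¹ → x * x⁻¹ ≈ 1#

  IsNonzero : Carrier → Set ℓ
  IsNonzero x = ¬ (x ≈ 0#)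

  pow : Carrier → ℕ → Carrier
  pow x zero    = 1#
  pow x (suc n) = pow x n * x

  sgn : ℕ → Carrier
  sgn i = pow (- 1#) i

  nat : ℕ → Carrier
  nat zero    = 0#
  nat (suc n) = 1# + nat n

  sumTo : ℕ → (ℕ → Carrier) → Carrier
  sumTo zero    f = 0#
  sumTo (suc n) f = sumTo n f + f n

  L : Carrier → Carrier → (ℕ → Carrier) → (ℕ → Carrier)
  L h y a n = sumTo (suc n) (λ i → nat (n C i) * pow h i * pow y (n ∸ i) * a i)

  -- a_n = c_1 a_{n-1} + ... + c_r a_{n-r} for all n ≥ r
  -- (coefficients c_1..c_r given as c 1, ..., c r; c 0 unused)
  IsLinRec : ℕ → (ℕ → Carrier) → (ℕ → Carrier) → Set ℓ
  IsLinRec r cf a = ∀ n → r ≤ n → a n ≈ sumTo r (λ j → cf (suc j) * a (n ∸ suc j))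

  -- convention σ_0 = 1 (σ 0 itself is ignored)
  withOne : (ℕ → Carrier) → ℕ → Carrier
  withOne σ zero    = 1#
  withOne σ (suc k) = σ (suc k)

  -- f(t) = t^r + Σ_{i=1}^r (-1)^i σ_i t^{r-i} = t^r - Σ c_i t^{r-i},
  -- so the recurrence coefficients are c_i = -((-1)^i σ_i)
  recCoeffs : (ℕ → Carrier) → ℕ → Carrier
  recCoeffs σ i = - (sgn i * σ i)

  -- polynomials as coefficient lists, constant term first
  Poly : Set c
  Poly = List Carrier

  _≈ₚ_ : Poly → Poly → Set (c ⊔ ℓ)
  p ≈ₚ q = Pointwise _≈_ p q

  addP : Poly → Poly → Poly
  addP []       q        = q
  addP (a ∷ p)  []       = a ∷ p
  addP (a ∷ p)  (b ∷ q)  = (a + b) ∷ addP p q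

  scaleP : Carrier → Poly → Poly
  scaleP a = map (a *_)

  mulP : Poly → Poly → Poly
  mulP []      q = []
  mulP (a ∷ p) q = addP (scaleP a q) (0# ∷ mulP p q)

  linProd : List Carrier → Poly
  linProd []       = 1# ∷ []
  linProd (α ∷ αs) = mulP ((- α) ∷ 1# ∷ []) (linProd αs)

  charPoly : ℕ → (ℕ → Carrier) → Poly
  charPoly r σ = reverse (map (λ i → sgn i * withOne σ i) (upTo (suc r)))

  σbar : ℕ → Carrier → Carrier → (ℕ → Carrier) → ℕ → Carrier
  σbar r h y σ i =
    sumTo (suc i) (λ k → nat ((r ∸ k) C (i ∸ k)) * pow h k * pow y (i ∸ k) * withOne σ k)

{-# OPTIONS --safe #-}
module Submission where

-- Write E for the shift a ↦ a ∘ suc. A sequence a satisfies the recurrence iff f(E) a = 0, and the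
-- binomial operator intertwines shifts: (E − y) L a = h L (E a). Hence the polynomial
-- g(t) = h^r f((t − y)/h) = Σ_k (−1)^k σ_k h^k (t − y)^(r−k), whose coefficients are the σ̄_i,
-- satisfies g(E) L a = h^r L (f(E) a) = 0. Independently, the elementary symmetric functions of the
-- h α_j + y arise from those of the α_j by the same transformation, by induction on the list of roots
-- using e_i(b ∷ α) = e_i(α) + b e_(i−1)(α) and Pascal's rule. Comparing coefficients in
-- f = ∏ (t − α_j) gives σ_i = e_i(α), and therefore g = ∏ (t − (h α_j + y)).

open import Defs
open import Level using (Level)
open import Data.Nat using (ℕ; zero; suc; _∸_; _≤_; _<_; s≤s) renaming (_+_ to _+ℕ_)
open import Data.Nat.Properties
  using (≤-refl; ≤-trans; m<n⇒m<1+n; m<1+n⇒m<n∨m≡n; _≤?_; ≰⇒>; n<1+n; +-∸-assoc; ∸-+-assoc; m+n∸m≡n;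
         m+[n∸m]≡n; m∸n+n≡m; n∸n≡0; m≤n+m)
import Data.Nat.Properties as ℕₚ
open import Data.Nat.Combinatorics using (_C_; nCk+nC[k+1]≡[n+1]C[k+1]; k>n⇒nCk≡0)
open import Data.List using (List; []; _∷_; map; length; reverse; upTo; applyDownFrom)
open import Data.List.Properties using (reverse-map; reverse-upTo; map-downFrom; length-map)
open import Data.List.Relation.Binary.Pointwise as Pointwise using (Pointwise; []; _∷_)
open import Data.Product using (_×_; _,_)
open import Data.Sum using (inj₁; inj₂)
open import Relation.Nullary using (yes; no)
import Relation.Binary.Reasoning.Setoid as SetoidReasoning
open import Function using (_∘_)
open import Relation.Binary.PropositionalEquality as ≡ using (_≡_)
open import Algebra.Bundles using (CommutativeRing)
open import Algebra.Morphism.Structures using (module RingMorphisms)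

module _ {a b r} {A : Set a} {B : Set b} {_∼_ : A → B → Set r} {f : ℕ → A} {g : ℕ → B} where

  applyDownFrom⁺ : ∀ n → (∀ i → i < n → f i ∼ g i) → Pointwise _∼_ (applyDownFrom f n) (applyDownFrom g n)
  applyDownFrom⁺ zero    f∼g = []
  applyDownFrom⁺ (suc n) f∼g = f∼g n ≤-refl ∷ applyDownFrom⁺ n (λ i i<n → f∼g i (m<n⇒m<1+n i<n))

  applyDownFrom⁻ : ∀ n → Pointwise _∼_ (applyDownFrom f n) (applyDownFrom g n) → ∀ i → i < n → f i ∼ g i
  applyDownFrom⁻ (suc n) (fn∼gn ∷ f∼g) i i<1+n with m<1+n⇒m<n∨m≡n i<1+n
  ... | inj₁ i<n    = applyDownFrom⁻ n f∼g i i<n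
  ... | inj₂ ≡.refl = fn∼gn

reverse-map-upTo : ∀ {a} {A : Set a} (f : ℕ → A) n → reverse (map f (upTo n)) ≡ applyDownFrom f n
reverse-map-upTo f n = ≡.trans (≡.sym (reverse-map f (upTo n)))
  (≡.trans (≡.cong (map f) (reverse-upTo n)) (map-downFrom f n))

module Sums {c ℓ : Level} (R : CommutativeRing c ℓ) where
  open CommutativeRing R
  open CR R
  open SetoidReasoning setoid
  open import Algebra.Properties.CommutativeSemigroup +-commutativeSemigroup using (interchange)
  open import Algebra.Properties.Ring ring using (-‿+-comm; -0#≈0#)

  sumTo-cong : ∀ n {f g : ℕ → Carrier} → (∀ k → k < n → f k ≈ g k) → sumTo n f ≈ sumTo n g
  sumTo-cong zero    f≈g = refl
  sumTo-cong (suc n) f≈g = +-cong (sumTo-cong n (λ k k<n → f≈g k (m<n⇒m<1+n k<n))) (f≈g n ≤-refl)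

  sumTo-zero : ∀ n {f : ℕ → Carrier} → (∀ k → k < n → f k ≈ 0#) → sumTo n f ≈ 0#
  sumTo-zero zero    f≈0 = refl
  sumTo-zero (suc n) f≈0 =
    trans (+-cong (sumTo-zero n (λ k k<n → f≈0 k (m<n⇒m<1+n k<n))) (f≈0 n ≤-refl)) (+-identityˡ 0#)

  sumTo-+ : ∀ n (f g : ℕ → Carrier) → sumTo n (λ k → f k + g k) ≈ sumTo n f + sumTo n g
  sumTo-+ zero    f g = sym (+-identityˡ 0#)
  sumTo-+ (suc n) f g = trans (+-congʳ (sumTo-+ n f g)) (interchange _ _ _ _)

  *-distribˡ-sumTo : ∀ n a (f : ℕ → Carrier) → a * sumTo n f ≈ sumTo n (λ k → a * f k)
  *-distribˡ-sumTo zero    a f = zeroʳ a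
  *-distribˡ-sumTo (suc n) a f = trans (distribˡ a (sumTo n f) (f n)) (+-congʳ (*-distribˡ-sumTo n a f))

  *-distribʳ-sumTo : ∀ n a (f : ℕ → Carrier) → sumTo n f * a ≈ sumTo n (λ k → f k * a)
  *-distribʳ-sumTo n a f =
    trans (*-comm _ a) (trans (*-distribˡ-sumTo n a f) (sumTo-cong n (λ k _ → *-comm a (f k))))

  -‿sumTo : ∀ n (f : ℕ → Carrier) → - sumTo n f ≈ sumTo n (λ k → - f k)
  -‿sumTo zero    f = -0#≈0#
  -‿sumTo (suc n) f = trans (sym (-‿+-comm (sumTo n f) (f n))) (+-congʳ (-‿sumTo n f))

  sumTo-suc : ∀ n (f : ℕ → Carrier) → sumTo (suc n) f ≈ f 0 + sumTo n (f ∘ suc)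
  sumTo-suc zero    f = trans (+-identityˡ (f 0)) (sym (+-identityʳ (f 0)))
  sumTo-suc (suc n) f = trans (+-congʳ (sumTo-suc n f)) (+-assoc _ _ _)

  sumTo-comm : ∀ m n (F : ℕ → ℕ → Carrier) →
    sumTo m (λ i → sumTo n (F i)) ≈ sumTo n (λ k → sumTo m (λ i → F i k))
  sumTo-comm zero    n F = sym (sumTo-zero n (λ _ _ → refl))
  sumTo-comm (suc m) n F = trans (+-congʳ (sumTo-comm m n F)) (sym (sumTo-+ n _ _))

  sumTo-triangle : ∀ N (F : ℕ → ℕ → Carrier) →
    sumTo N (λ i → sumTo (suc i) (F i)) ≈ sumTo N (λ k → sumTo (N ∸ k) (λ j → F (k +ℕ j) k))
  sumTo-triangle zero    F = refl
  sumTo-triangle (suc N) F = begin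
      sumTo N (λ i → sumTo (suc i) (F i)) + sumTo (suc N) (F N)
    ≈⟨ +-congʳ (sumTo-triangle N F) ⟩
      sumTo N (λ k → inner N k) + sumTo (suc N) (F N)
    ≈⟨ +-congʳ (sym (trans (+-congˡ empty) (+-identityʳ _))) ⟩
      sumTo (suc N) (λ k → inner N k) + sumTo (suc N) (F N)
    ≈⟨ sym (sumTo-+ (suc N) _ _) ⟩
      sumTo (suc N) (λ k → inner N k + F N k)
    ≈⟨ sumTo-cong (suc N) extend ⟩
      sumTo (suc N) (λ k → inner (suc N) k) ∎
    where
    inner : ℕ → ℕ → Carrier
    inner M k = sumTo (M ∸ k) (λ j → F (k +ℕ j) k)
    empty : inner N N ≈ 0#
    empty = reflexive (≡.cong (λ n → sumTo n (λ j → F (N +ℕ j) N)) (n∸n≡0 N))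
    extend : ∀ k → k < suc N → inner N k + F N k ≈ inner (suc N) k
    extend k (s≤s k≤N) rewrite +-∸-assoc 1 k≤N =
      +-congˡ (reflexive (≡.cong (λ i → F i k) (≡.sym (m+[n∸m]≡n k≤N))))

module Binomials {c ℓ : Level} (R : CommutativeRing c ℓ) where
  open CommutativeRing R
  open CR R
  open Sums R
  open SetoidReasoning setoid
  open import Algebra.Properties.CommutativeSemigroup *-commutativeSemigroup
    using () renaming (interchange to *-interchange)
  open import Algebra.Properties.Ring ring using (-1*x≈-x; -‿involutive)
  open import Algebra.Solver.Ring.NaturalCoefficients.Default commutativeSemiring

  nat-+ : ∀ m n → nat (m +ℕ n) ≈ nat m + nat n
  nat-+ zero    n = sym (+-identityˡ _)
  nat-+ (suc m) n = trans (+-congˡ (nat-+ m n)) (sym (+-assoc _ _ _))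

  pow-+ : ∀ x m n → pow x (m +ℕ n) ≈ pow x m * pow x n
  pow-+ x m zero    = trans (reflexive (≡.cong (pow x) (ℕₚ.+-identityʳ m))) (sym (*-identityʳ _))
  pow-+ x m (suc n) = begin
    pow x (m +ℕ suc n)      ≈⟨ reflexive (≡.cong (pow x) (ℕₚ.+-suc m n)) ⟩
    pow x (m +ℕ n) * x      ≈⟨ *-congʳ (pow-+ x m n) ⟩
    pow x m * pow x n * x   ≈⟨ *-assoc _ _ _ ⟩
    pow x m * pow x (suc n) ∎

  sgn-+ : ∀ m n → sgn (m +ℕ n) ≈ sgn m * sgn n
  sgn-+ = pow-+ (- 1#)

  -1*-1≈1 : - 1# * - 1# ≈ 1#
  -1*-1≈1 = trans (-1*x≈-x (- 1#)) (-‿involutive 1#)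

  sgn-*-sgn : ∀ i → sgn i * sgn i ≈ 1#
  sgn-*-sgn zero    = *-identityˡ 1#
  sgn-*-sgn (suc i) = begin
    sgn i * - 1# * (sgn i * - 1#)  ≈⟨ *-interchange _ _ _ _ ⟩
    sgn i * sgn i * (- 1# * - 1#)  ≈⟨ *-cong (sgn-*-sgn i) -1*-1≈1 ⟩
    1# * 1#                        ≈⟨ *-identityˡ 1# ⟩
    1#                             ∎

  sgn-cancelˡ : ∀ i {x z} → sgn i * x ≈ sgn i * z → x ≈ z
  sgn-cancelˡ i {x} {z} eq = trans (sym (sgn-twice x)) (trans (*-congˡ eq) (sgn-twice z))
    where
    sgn-twice : ∀ w → sgn i * (sgn i * w) ≈ w
    sgn-twice w = trans (sym (*-assoc _ _ _)) (trans (*-congʳ (sgn-*-sgn i)) (*-identityˡ w))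

  pow-neg : ∀ y j → pow (- y) j ≈ sgn j * pow y j
  pow-neg y zero    = sym (*-identityˡ 1#)
  pow-neg y (suc j) = begin
    pow (- y) j * - y                 ≈⟨ *-cong (pow-neg y j) (sym (-1*x≈-x y)) ⟩
    sgn j * pow y j * (- 1# * y)      ≈⟨ *-interchange _ _ _ _ ⟩
    sgn j * - 1# * (pow y j * y)      ∎

  pascal-sumTo : ∀ N (f : ℕ → Carrier) →
    sumTo (suc (suc N)) (λ i → nat (suc N C i) * f i)
      ≈ sumTo (suc N) (λ i → nat (N C i) * f i) + sumTo (suc N) (λ i → nat (N C i) * f (suc i))
  pascal-sumTo N f = begin
      sumTo (suc (suc N)) (λ i → nat (suc N C i) * f i)
    ≈⟨ sumTo-suc (suc N) _ ⟩
      nat 1 * f 0 + sumTo (suc N) (λ i → nat (suc N C suc i) * f (suc i))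
    ≈⟨ +-congˡ (trans (sumTo-cong (suc N) (λ i _ → pascal i)) (sumTo-+ (suc N) _ _)) ⟩
      nat 1 * f 0 + (B + (sumTo N (λ i → nat (N C suc i) * f (suc i)) + nat (N C suc N) * f (suc N)))
    ≈⟨ +-congˡ (+-congˡ (trans (+-congˡ top-vanishes) (+-identityʳ _))) ⟩
      nat 1 * f 0 + (B + sumTo N (λ i → nat (N C suc i) * f (suc i)))
    ≈⟨ solve 3 (λ a b s → a :+ (b :+ s) := (a :+ s) :+ b) refl _ _ _ ⟩
      (nat 1 * f 0 + sumTo N (λ i → nat (N C suc i) * f (suc i))) + B
    ≈⟨ +-congʳ (sym (sumTo-suc N _)) ⟩
      sumTo (suc N) (λ i → nat (N C i) * f i) + B ∎
    where
    B = sumTo (suc N) (λ i → nat (N C i) * f (suc i))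
    pascal : ∀ i → nat (suc N C suc i) * f (suc i) ≈ nat (N C i) * f (suc i) + nat (N C suc i) * f (suc i)
    pascal i = trans (*-congʳ (trans (reflexive (≡.cong nat (≡.sym (nCk+nC[k+1]≡[n+1]C[k+1] N i))))
                                     (nat-+ (N C i) (N C suc i))))
                     (distribʳ _ _ _)
    top-vanishes : nat (N C suc N) * f (suc N) ≈ 0#
    top-vanishes = trans (*-congʳ (reflexive (≡.cong nat (k>n⇒nCk≡0 (n<1+n N))))) (zeroˡ _)

module Coefficients {c ℓ : Level} (R : CommutativeRing c ℓ) where
  open CommutativeRing R
  open CR R
  open Sums R
  open Binomials R
  open SetoidReasoning setoid
  open import Algebra.Solver.Ring.NaturalCoefficients.Default commutativeSemiring

  charCoeffs : (ℕ → Carrier) → ℕ → Carrier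
  charCoeffs σ i = sgn i * withOne σ i

  -- σbar r h y σ = affineSym h y r (withOne σ); leaving the zeroth term free makes affineSym linear.
  affineSym : Carrier → Carrier → ℕ → (ℕ → Carrier) → ℕ → Carrier
  affineSym h y r s i = sumTo (suc i) (λ k → nat ((r ∸ k) C (i ∸ k)) * pow h k * pow y (i ∸ k) * s k)

  affineSym-cong : ∀ h y r i {s s′ : ℕ → Carrier} → (∀ k → k ≤ i → s k ≈ s′ k) →
    affineSym h y r s i ≈ affineSym h y r s′ i
  affineSym-cong h y r i s≈s′ = sumTo-cong (suc i) (λ { k (s≤s k≤i) → *-congˡ (s≈s′ k k≤i) })

  affineSym-zero : ∀ h y r s → affineSym h y r s 0 ≈ s 0
  affineSym-zero h y r s = begin
    0# + nat 1 * 1# * 1# * s 0 ≈⟨ +-identityˡ _ ⟩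
    nat 1 * 1# * 1# * s 0      ≈⟨ *-congʳ (trans (*-identityʳ _) (trans (*-identityʳ _) (+-identityʳ 1#))) ⟩
    1# * s 0                   ≈⟨ *-identityˡ _ ⟩
    s 0                        ∎

  withOne-σbar : ∀ r h y σ i → withOne (σbar r h y σ) i ≈ affineSym h y r (withOne σ) i
  withOne-σbar r h y σ zero    = sym (affineSym-zero h y r (withOne σ))
  withOne-σbar r h y σ (suc i) = refl

  affineSym-linear : ∀ h y r i (s s′ : ℕ → Carrier) b →
    affineSym h y r (λ k → s k + b * s′ k) i ≈ affineSym h y r s i + b * affineSym h y r s′ i
  affineSym-linear h y r i s s′ b = begin
      affineSym h y r (λ k → s k + b * s′ k) i
    ≈⟨ sumTo-cong (suc i) (λ k _ → solve 6 (λ n p q u v w → n :* p :* q :* (u :+ w :* v) := n :* p :* q :* u :+ w :* (n :* p :* q :* v)) refl _ _ _ _ _ _) ⟩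
      sumTo (suc i) (λ k → term s k + b * term s′ k)
    ≈⟨ sumTo-+ (suc i) _ _ ⟩
      affineSym h y r s i + sumTo (suc i) (λ k → b * term s′ k)
    ≈⟨ +-congˡ (sym (*-distribˡ-sumTo (suc i) b _)) ⟩
      affineSym h y r s i + b * affineSym h y r s′ i ∎
    where
    term : (ℕ → Carrier) → ℕ → Carrier
    term t k = nat ((r ∸ k) C (i ∸ k)) * pow h k * pow y (i ∸ k) * t k

  delay : (ℕ → Carrier) → ℕ → Carrier
  delay s zero    = 0#
  delay s (suc k) = s k

  affineSym-delay : ∀ h y r i s → affineSym h y (suc r) (delay s) (suc i) ≈ h * affineSym h y r s i
  affineSym-delay h y r i s = begin
      affineSym h y (suc r) (delay s) (suc i)
    ≈⟨ sumTo-suc (suc i) _ ⟩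
      _ * 0# + sumTo (suc i) (λ k → nat ((r ∸ k) C (i ∸ k)) * (pow h k * h) * pow y (i ∸ k) * s k)
    ≈⟨ +-cong (zeroʳ _) (sumTo-cong (suc i) (λ k _ → solve 5 (λ n p q u w → n :* (p :* w) :* q :* u := w :* (n :* p :* q :* u)) refl _ _ _ _ _)) ⟩
      0# + sumTo (suc i) (λ k → h * (nat ((r ∸ k) C (i ∸ k)) * pow h k * pow y (i ∸ k) * s k))
    ≈⟨ trans (+-identityˡ _) (sym (*-distribˡ-sumTo (suc i) h _)) ⟩
      h * affineSym h y r s i ∎

  affineSym-suc : ∀ h y r i s → (∀ k → r < k → s k ≈ 0#) →
    affineSym h y (suc r) s (suc i) ≈ affineSym h y r s (suc i) + y * affineSym h y r s i
  affineSym-suc h y r i s s>r≈0 = begin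
      sumTo (suc i) A + A (suc i)
    ≈⟨ +-cong (sumTo-cong (suc i) pascal) top ⟩
      sumTo (suc i) (λ k → B k + y * B′ k) + B (suc i)
    ≈⟨ +-congʳ (trans (sumTo-+ (suc i) _ _) (+-congˡ (sym (*-distribˡ-sumTo (suc i) y B′)))) ⟩
      (sumTo (suc i) B + y * sumTo (suc i) B′) + B (suc i)
    ≈⟨ solve 3 (λ a b c → (a :+ b) :+ c := (a :+ c) :+ b) refl _ _ _ ⟩
      (sumTo (suc i) B + B (suc i)) + y * sumTo (suc i) B′ ∎
    where
    A B B′ : ℕ → Carrier
    A k  = nat ((suc r ∸ k) C (suc i ∸ k)) * pow h k * pow y (suc i ∸ k) * s k
    B k  = nat ((r ∸ k) C (suc i ∸ k)) * pow h k * pow y (suc i ∸ k) * s k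
    B′ k = nat ((r ∸ k) C (i ∸ k)) * pow h k * pow y (i ∸ k) * s k
    top : A (suc i) ≈ B (suc i)
    top rewrite n∸n≡0 i = refl
    vanishes : ∀ {x} k → r < k → x * s k ≈ 0#
    vanishes k r<k = trans (*-congˡ (s>r≈0 k r<k)) (zeroʳ _)
    pascal : ∀ k → k < suc i → A k ≈ B k + y * B′ k
    pascal k (s≤s k≤i) with k ≤? r
    ... | no k≰r = trans (vanishes k (≰⇒> k≰r))
          (sym (trans (+-cong (vanishes k (≰⇒> k≰r)) (trans (*-congˡ (vanishes k (≰⇒> k≰r))) (zeroʳ y)))
                      (+-identityˡ 0#)))
    ... | yes k≤r rewrite +-∸-assoc 1 k≤i | +-∸-assoc 1 k≤r =
      trans (*-congʳ (*-congʳ (*-congʳ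
              (trans (reflexive (≡.cong nat (≡.sym (nCk+nC[k+1]≡[n+1]C[k+1] (r ∸ k) (i ∸ k)))))
                     (nat-+ ((r ∸ k) C (i ∸ k)) ((r ∸ k) C suc (i ∸ k)))))))
            (solve 6 (λ a b p q u w → (a :+ b) :* p :* (q :* w) :* u := b :* p :* (q :* w) :* u :+ w :* (a :* p :* q :* u)) refl _ _ _ _ _ _)

module Recurrences {c ℓ : Level} (R : CommutativeRing c ℓ) where
  open CommutativeRing R
  open CR R
  open Sums R
  open Binomials R
  open Coefficients R
  open SetoidReasoning setoid
  open import Algebra.Properties.Ring ring using (-‿distribˡ-*; -‿involutive; +-inverseˡ-unique)
  open import Algebra.Properties.CommutativeSemigroup *-commutativeSemigroup using (x∙yz≈y∙xz)
  open import Algebra.Solver.Ring.NaturalCoefficients.Default commutativeSemiring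

  -- (Σ_{i ≤ r} u i E^(r ∸ i)) a, evaluated at n, for the shift E a = a ∘ suc
  applyShiftPoly : ℕ → (ℕ → Carrier) → (ℕ → Carrier) → ℕ → Carrier
  applyShiftPoly r u a n = sumTo (suc r) (λ i → u i * a (n +ℕ (r ∸ i)))

  applyShiftPoly-charCoeffs : ∀ r σ (a : ℕ → Carrier) n →
    applyShiftPoly r (charCoeffs σ) a n
      ≈ a (n +ℕ r) + - sumTo r (λ j → recCoeffs σ (suc j) * a ((n +ℕ r) ∸ suc j))
  applyShiftPoly-charCoeffs r σ a n = begin
      applyShiftPoly r (charCoeffs σ) a n
    ≈⟨ sumTo-suc r _ ⟩
      1# * 1# * a (n +ℕ r) + sumTo r (λ j → charCoeffs σ (suc j) * a (n +ℕ (r ∸ suc j)))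
    ≈⟨ +-cong (trans (*-congʳ (*-identityˡ 1#)) (*-identityˡ _)) (sumTo-cong r negate-twice) ⟩
      a (n +ℕ r) + sumTo r (λ j → - (recCoeffs σ (suc j) * a ((n +ℕ r) ∸ suc j)))
    ≈⟨ +-congˡ (sym (-‿sumTo r _)) ⟩
      a (n +ℕ r) + - sumTo r (λ j → recCoeffs σ (suc j) * a ((n +ℕ r) ∸ suc j)) ∎
    where
    negate-twice : ∀ j → j < r →
      charCoeffs σ (suc j) * a (n +ℕ (r ∸ suc j)) ≈ - (recCoeffs σ (suc j) * a ((n +ℕ r) ∸ suc j))
    negate-twice j j<r rewrite +-∸-assoc n j<r =
      sym (trans (-‿cong (sym (-‿distribˡ-* _ _))) (-‿involutive _))

  isLinRec⇒annihilated : ∀ r σ (a : ℕ → Carrier) → IsLinRec r (recCoeffs σ) a →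
    ∀ n → applyShiftPoly r (charCoeffs σ) a n ≈ 0#
  isLinRec⇒annihilated r σ a rec n =
    trans (applyShiftPoly-charCoeffs r σ a n)
          (trans (+-congʳ (rec (n +ℕ r) (m≤n+m r n))) (-‿inverseʳ _))

  annihilated⇒isLinRec : ∀ r σ (a : ℕ → Carrier) → (∀ n → applyShiftPoly r (charCoeffs σ) a n ≈ 0#) →
    IsLinRec r (recCoeffs σ) a
  annihilated⇒isLinRec r σ a ann n r≤n =
    ≡.subst (λ m → a m ≈ sumTo r (λ j → recCoeffs σ (suc j) * a (m ∸ suc j))) (m∸n+n≡m r≤n)
      (trans (+-inverseˡ-unique _ _ (trans (sym (applyShiftPoly-charCoeffs r σ a (n ∸ r))) (ann (n ∸ r))))
             (-‿involutive _))

  L-cong : ∀ h y {a a′ : ℕ → Carrier} n → (∀ j → a j ≈ a′ j) → L h y a n ≈ L h y a′ n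
  L-cong h y n a≈a′ = sumTo-cong (suc n) (λ i _ → *-congˡ (a≈a′ i))

  L-zero : ∀ h y {a : ℕ → Carrier} → (∀ j → a j ≈ 0#) → ∀ n → L h y a n ≈ 0#
  L-zero h y a≈0 n = sumTo-zero (suc n) (λ i _ → trans (*-congˡ (a≈0 i)) (zeroʳ _))

  L-sumTo : ∀ h y n (u : ℕ → Carrier) (f : ℕ → ℕ → Carrier) m →
    L h y (λ j → sumTo n (λ k → u k * f k j)) m ≈ sumTo n (λ k → u k * L h y (f k) m)
  L-sumTo h y n u f m = begin
      sumTo (suc m) (λ i → coeff i * sumTo n (λ k → u k * f k i))
    ≈⟨ sumTo-cong (suc m) (λ i _ → trans (*-distribˡ-sumTo n (coeff i) _)
                                         (sumTo-cong n (λ k _ → x∙yz≈y∙xz _ _ _))) ⟩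
      sumTo (suc m) (λ i → sumTo n (λ k → u k * (coeff i * f k i)))
    ≈⟨ sumTo-comm (suc m) n _ ⟩
      sumTo n (λ k → sumTo (suc m) (λ i → u k * (coeff i * f k i)))
    ≈⟨ sumTo-cong n (λ k _ → sym (*-distribˡ-sumTo (suc m) (u k) _)) ⟩
      sumTo n (λ k → u k * L h y (f k) m) ∎
    where
    coeff : ℕ → Carrier
    coeff i = nat (m C i) * pow h i * pow y (m ∸ i)

  L-suc : ∀ h y (a : ℕ → Carrier) n → L h y a (suc n) ≈ y * L h y a n + h * L h y (a ∘ suc) n
  L-suc h y a n = begin
      L h y a (suc n)
    ≈⟨ sumTo-cong (suc (suc n)) (λ i _ → trans (*-assoc _ _ _) (*-assoc _ _ _)) ⟩
      sumTo (suc (suc n)) (λ i → nat (suc n C i) * f i)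
    ≈⟨ pascal-sumTo n f ⟩
      sumTo (suc n) (λ i → nat (n C i) * f i) + sumTo (suc n) (λ i → nat (n C i) * f (suc i))
    ≈⟨ +-cong (sumTo-cong (suc n) lower) (sumTo-cong (suc n) (λ i _ → solve 5 (λ c p q x u → c :* (p :* x :* (q :* u)) := x :* (c :* p :* q :* u)) refl _ _ _ _ _)) ⟩
      sumTo (suc n) (λ i → y * term a i) + sumTo (suc n) (λ i → h * term (a ∘ suc) i)
    ≈⟨ sym (+-cong (*-distribˡ-sumTo (suc n) y _) (*-distribˡ-sumTo (suc n) h _)) ⟩
      y * L h y a n + h * L h y (a ∘ suc) n ∎
    where
    f : ℕ → Carrier
    f i = pow h i * (pow y (suc n ∸ i) * a i)
    term : (ℕ → Carrier) → ℕ → Carrier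
    term b i = nat (n C i) * pow h i * pow y (n ∸ i) * b i
    lower : ∀ i → i < suc n → nat (n C i) * f i ≈ y * term a i
    lower i (s≤s i≤n) rewrite +-∸-assoc 1 i≤n =
      solve 5 (λ c p q x u → c :* (p :* (q :* x :* u)) := x :* (c :* p :* q :* u)) refl _ _ _ _ _

  Δ : Carrier → ℕ → (ℕ → Carrier) → ℕ → Carrier
  Δ y zero    b n = b n
  Δ y (suc M) b n = Δ y M b (suc n) + - y * Δ y M b n

  Δ-expand : ∀ y M b n → Δ y M b n ≈ applyShiftPoly M (λ j → nat (M C j) * pow (- y) j) b n
  Δ-expand y zero b n = sym (trans (+-identityˡ _)
    (trans (*-congʳ (trans (*-identityʳ _) (+-identityʳ 1#))) (trans (*-identityˡ _) (reflexive (≡.cong b (ℕₚ.+-identityʳ n))))))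
  Δ-expand y (suc M) b n = begin
      Δ y M b (suc n) + - y * Δ y M b n
    ≈⟨ +-cong (Δ-expand y M b (suc n)) (*-congˡ (Δ-expand y M b n)) ⟩
      sumTo (suc M) (λ j → nat (M C j) * pow (- y) j * b (suc n +ℕ (M ∸ j))) + - y * applyShiftPoly M coeff b n
    ≈⟨ +-cong (sumTo-cong (suc M) lower) (*-distribˡ-sumTo (suc M) (- y) _) ⟩
      sumTo (suc M) (λ j → nat (M C j) * f j) + sumTo (suc M) (λ j → - y * (coeff j * b (n +ℕ (M ∸ j))))
    ≈⟨ +-congˡ (sumTo-cong (suc M) (λ j _ → solve 4 (λ z c p x → z :* (c :* p :* x) := c :* (p :* z :* x)) refl _ _ _ _)) ⟩
      sumTo (suc M) (λ j → nat (M C j) * f j) + sumTo (suc M) (λ j → nat (M C j) * f (suc j))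
    ≈⟨ sym (pascal-sumTo M f) ⟩
      sumTo (suc (suc M)) (λ j → nat (suc M C j) * f j)
    ≈⟨ sumTo-cong (suc (suc M)) (λ j _ → sym (*-assoc _ _ _)) ⟩
      applyShiftPoly (suc M) (λ j → nat (suc M C j) * pow (- y) j) b n ∎
    where
    coeff : ℕ → Carrier
    coeff j = nat (M C j) * pow (- y) j
    f : ℕ → Carrier
    f j = pow (- y) j * b (n +ℕ (suc M ∸ j))
    lower : ∀ j → j < suc M → nat (M C j) * pow (- y) j * b (suc n +ℕ (M ∸ j)) ≈ nat (M C j) * f j
    lower j (s≤s j≤M) rewrite +-∸-assoc 1 j≤M | ℕₚ.+-suc n (M ∸ j) = *-assoc _ _ _

  Δ-L : ∀ h y a M n → Δ y M (L h y a) n ≈ pow h M * L h y (λ j → a (j +ℕ M)) n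
  Δ-L h y a zero n =
    trans (L-cong h y n (λ j → reflexive (≡.cong a (≡.sym (ℕₚ.+-identityʳ j))))) (sym (*-identityˡ _))
  Δ-L h y a (suc M) n = begin
      Δ y M (L h y a) (suc n) + - y * Δ y M (L h y a) n
    ≈⟨ +-cong (Δ-L h y a M (suc n)) (*-congˡ (Δ-L h y a M n)) ⟩
      pow h M * L h y aM (suc n) + - y * (pow h M * L h y aM n)
    ≈⟨ +-congʳ (*-congˡ (L-suc h y aM n)) ⟩
      pow h M * (y * L h y aM n + h * L h y (aM ∘ suc) n) + - y * (pow h M * L h y aM n)
    ≈⟨ solve 6 (λ p z z′ x w v → p :* (z :* x :+ w :* v) :+ z′ :* (p :* x) := (z :+ z′) :* (p :* x) :+ p :* w :* v) refl _ _ _ _ _ _ ⟩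
      (y + - y) * (pow h M * L h y aM n) + pow h (suc M) * L h y (aM ∘ suc) n
    ≈⟨ +-cong (trans (*-congʳ (-‿inverseʳ y)) (zeroˡ _))
              (*-congˡ (L-cong h y n (λ j → reflexive (≡.cong a (≡.sym (ℕₚ.+-suc j M)))))) ⟩
      0# + pow h (suc M) * L h y (λ j → a (j +ℕ suc M)) n
    ≈⟨ +-identityˡ _ ⟩
      pow h (suc M) * L h y (λ j → a (j +ℕ suc M)) n ∎
    where
    aM : ℕ → Carrier
    aM j = a (j +ℕ M)

  applyShiftPoly-L : ∀ h y r (s a : ℕ → Carrier) m →
    applyShiftPoly r (λ i → sgn i * affineSym h y r s i) (L h y a) m
      ≈ pow h r * L h y (applyShiftPoly r (λ k → sgn k * s k) a) m
  applyShiftPoly-L h y r s a m = begin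
      sumTo (suc r) (λ i → sgn i * affineSym h y r s i * b (m +ℕ (r ∸ i)))
    ≈⟨ sumTo-cong (suc r) (λ i _ → expand i) ⟩
      sumTo (suc r) (λ i → sumTo (suc i) (F i))
    ≈⟨ sumTo-triangle (suc r) F ⟩
      sumTo (suc r) (λ k → sumTo (suc r ∸ k) (λ j → F (k +ℕ j) k))
    ≈⟨ sumTo-cong (suc r) column ⟩
      sumTo (suc r) (λ k → pow h r * (u k * L h y (shifted k) m))
    ≈⟨ sym (*-distribˡ-sumTo (suc r) (pow h r) _) ⟩
      pow h r * sumTo (suc r) (λ k → u k * L h y (shifted k) m)
    ≈⟨ *-congˡ (sym (L-sumTo h y (suc r) u shifted m)) ⟩
      pow h r * L h y (applyShiftPoly r u a) m ∎
    where
    b = L h y a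
    u : ℕ → Carrier
    u k = sgn k * s k
    shifted : ℕ → ℕ → Carrier
    shifted k j = a (j +ℕ (r ∸ k))
    F : ℕ → ℕ → Carrier
    F i k = sgn i * (nat ((r ∸ k) C (i ∸ k)) * pow h k * pow y (i ∸ k) * s k) * b (m +ℕ (r ∸ i))
    expand : ∀ i → sgn i * affineSym h y r s i * b (m +ℕ (r ∸ i)) ≈ sumTo (suc i) (F i)
    expand i = trans (*-congʳ (*-distribˡ-sumTo (suc i) (sgn i) _)) (*-distribʳ-sumTo (suc i) _ _)
    -- the k-th column is u k h^k (E - y)^(r - k) b, and (E - y) L = h L E
    column : ∀ k → k < suc r → sumTo (suc r ∸ k) (λ j → F (k +ℕ j) k) ≈ pow h r * (u k * L h y (shifted k) m)
    column k (s≤s k≤r) rewrite +-∸-assoc 1 k≤r = begin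
        sumTo (suc (r ∸ k)) (λ j → F (k +ℕ j) k)
      ≈⟨ sumTo-cong (suc (r ∸ k)) (λ j _ → entry j) ⟩
        sumTo (suc (r ∸ k)) (λ j → u k * pow h k * (nat ((r ∸ k) C j) * pow (- y) j * b (m +ℕ ((r ∸ k) ∸ j))))
      ≈⟨ sym (*-distribˡ-sumTo (suc (r ∸ k)) _ _) ⟩
        u k * pow h k * applyShiftPoly (r ∸ k) (λ j → nat ((r ∸ k) C j) * pow (- y) j) b m
      ≈⟨ *-congˡ (sym (Δ-expand y (r ∸ k) b m)) ⟩
        u k * pow h k * Δ y (r ∸ k) b m
      ≈⟨ *-congˡ (Δ-L h y a (r ∸ k) m) ⟩
        u k * pow h k * (pow h (r ∸ k) * L h y (shifted k) m)
      ≈⟨ solve 4 (λ v p q l → v :* p :* (q :* l) := p :* q :* (v :* l)) refl _ _ _ _ ⟩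
        pow h k * pow h (r ∸ k) * (u k * L h y (shifted k) m)
      ≈⟨ *-congʳ (trans (sym (pow-+ h k (r ∸ k))) (reflexive (≡.cong (pow h) (m+[n∸m]≡n k≤r)))) ⟩
        pow h r * (u k * L h y (shifted k) m) ∎
      where
      entry : ∀ j → F (k +ℕ j) k ≈ u k * pow h k * (nat ((r ∸ k) C j) * pow (- y) j * b (m +ℕ ((r ∸ k) ∸ j)))
      entry j rewrite m+n∸m≡n k j | ≡.sym (∸-+-assoc r k j) =
        trans (*-congʳ (*-congʳ (sgn-+ k j)))
          (trans (solve 7 (λ sk sj c p q t x → sk :* sj :* (c :* p :* q :* t) :* x := sk :* t :* p :* (c :* (sj :* q) :* x)) refl _ _ _ _ _ _ _)
                 (*-congˡ (*-congʳ (*-congˡ (sym (pow-neg y j))))))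

  L-isLinRec : ∀ h y r σ (a : ℕ → Carrier) → IsLinRec r (recCoeffs σ) a →
    IsLinRec r (recCoeffs (σbar r h y σ)) (L h y a)
  L-isLinRec h y r σ a rec = annihilated⇒isLinRec r (σbar r h y σ) (L h y a) λ m → begin
      applyShiftPoly r (charCoeffs (σbar r h y σ)) (L h y a) m
    ≈⟨ sumTo-cong (suc r) (λ i _ → *-congʳ (*-congˡ (withOne-σbar r h y σ i))) ⟩
      applyShiftPoly r (λ i → sgn i * affineSym h y r (withOne σ) i) (L h y a) m
    ≈⟨ applyShiftPoly-L h y r (withOne σ) a m ⟩
      pow h r * L h y (applyShiftPoly r (charCoeffs σ) a) m
    ≈⟨ *-congˡ (L-zero h y (isLinRec⇒annihilated r σ a rec) m) ⟩
      pow h r * 0#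
    ≈⟨ zeroʳ _ ⟩
      0# ∎

module Polynomials {c ℓ : Level} (R : CommutativeRing c ℓ) where
  open CommutativeRing R
  open CR R
  open Sums R
  open Binomials R
  open Coefficients R
  open import Algebra.Properties.Ring ring using (-1*x≈-x)
  open import Algebra.Solver.Ring.NaturalCoefficients.Default commutativeSemiring
  module ≈-Reasoning = SetoidReasoning setoid
  module ≈ₚ-Reasoning = SetoidReasoning (Pointwise.setoid setoid)

  esym : ℕ → List Carrier → Carrier
  esym zero    α       = 1#
  esym (suc i) []      = 0#
  esym (suc i) (b ∷ α) = esym (suc i) α + b * esym i α

  esym-vanish : ∀ α i → length α < i → esym i α ≈ 0#
  esym-vanish []      (suc i) _ = refl
  esym-vanish (b ∷ α) (suc i) (s≤s |α|<i) =
    trans (+-cong (esym-vanish α (suc i) (m<n⇒m<1+n |α|<i)) (trans (*-congˡ (esym-vanish α i |α|<i)) (zeroʳ b)))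
          (+-identityˡ 0#)

  esym-affine : ∀ h y α i → esym i (map (λ x → h * x + y) α) ≈ affineSym h y (length α) (λ k → esym k α) i
  esym-affine h y [] zero    = sym (affineSym-zero h y 0 (λ k → esym k []))
  esym-affine h y [] (suc i) = sym (sumTo-zero (suc (suc i)) λ
    { zero    _ → trans (*-congʳ (trans (*-congʳ (zeroˡ _)) (zeroˡ _))) (zeroˡ _)
    ; (suc k) _ → zeroʳ _ })
  esym-affine h y (b ∷ α) zero    = sym (affineSym-zero h y (suc (length α)) (λ k → esym k (b ∷ α)))
  esym-affine h y (b ∷ α) (suc i) = begin
      esym (suc i) (map φ α) + (h * b + y) * esym i (map φ α)
    ≈⟨ +-cong (esym-affine h y α (suc i)) (*-congˡ (esym-affine h y α i)) ⟩
      affineSym h y r e (suc i) + (h * b + y) * affineSym h y r e i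
    ≈⟨ solve 5 (λ a x h′ b′ y′ → a :+ (h′ :* b′ :+ y′) :* x := (a :+ y′ :* x) :+ b′ :* (h′ :* x)) refl _ _ _ _ _ ⟩
      (affineSym h y r e (suc i) + y * affineSym h y r e i) + b * (h * affineSym h y r e i)
    ≈⟨ sym (+-cong (affineSym-suc h y r i e (esym-vanish α)) (*-congˡ (affineSym-delay h y r i e))) ⟩
      affineSym h y (suc r) e (suc i) + b * affineSym h y (suc r) (delay e) (suc i)
    ≈⟨ sym (affineSym-linear h y (suc r) (suc i) e (delay e) b) ⟩
      affineSym h y (suc r) (λ k → e k + b * delay e k) (suc i)
    ≈⟨ affineSym-cong h y (suc r) (suc i) (λ { zero _ → trans (+-congˡ (zeroʳ b)) (+-identityʳ 1#) ; (suc k) _ → refl }) ⟩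
      affineSym h y (suc r) (λ k → esym k (b ∷ α)) (suc i) ∎
    where
    open ≈-Reasoning
    φ : Carrier → Carrier
    φ x = h * x + y
    r = length α
    e : ℕ → Carrier
    e k = esym k α

  addP-cong : ∀ {p p′ q q′} → p ≈ₚ p′ → q ≈ₚ q′ → addP p q ≈ₚ addP p′ q′
  addP-cong []         q≈q′       = q≈q′
  addP-cong (x≈ ∷ p≈)  []         = x≈ ∷ p≈
  addP-cong (x≈ ∷ p≈)  (y≈ ∷ q≈)  = +-cong x≈ y≈ ∷ addP-cong p≈ q≈

  addP-identityʳ : ∀ p → addP p [] ≡ p
  addP-identityʳ []      = ≡.refl
  addP-identityʳ (x ∷ p) = ≡.refl

  scaleP-congʳ : ∀ a {p q} → p ≈ₚ q → scaleP a p ≈ₚ scaleP a q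
  scaleP-congʳ a = Pointwise.map⁺ (a *_) (a *_) ∘ Pointwise.map *-congˡ

  scaleP-identityˡ : ∀ p → scaleP 1# p ≈ₚ p
  scaleP-identityˡ []      = []
  scaleP-identityˡ (x ∷ p) = *-identityˡ x ∷ scaleP-identityˡ p

  mulP-congʳ : ∀ p {q q′} → q ≈ₚ q′ → mulP p q ≈ₚ mulP p q′
  mulP-congʳ []      q≈q′ = []
  mulP-congʳ (a ∷ p) q≈q′ = addP-cong (scaleP-congʳ a q≈q′) (refl ∷ mulP-congʳ p q≈q′)

  -- [1] is a left unit only on nonempty lists: mulP (1# ∷ []) [] is 0# ∷ []
  mulP-identityˡ : ∀ x p → mulP (1# ∷ []) (x ∷ p) ≈ₚ (x ∷ p)
  mulP-identityˡ x p =
    trans (+-identityʳ _) (*-identityˡ x) ∷ ≡.subst (_≈ₚ p) (≡.sym (addP-identityʳ (scaleP 1# p))) (scaleP-identityˡ p)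

  -- coefficients of (t + c) · Σ g i t^(n - i), listed from the leading one
  timesLinear : Carrier → (ℕ → Carrier) → ℕ → Carrier
  timesLinear c g zero    = g 0
  timesLinear c g (suc i) = c * g i + g (suc i)

  addP-scaleP-∷ : ∀ n c z g → addP (scaleP c (applyDownFrom g (suc n))) (z ∷ applyDownFrom g (suc n))
                               ≈ₚ ((c * g n + z) ∷ applyDownFrom (timesLinear c g) (suc n))
  addP-scaleP-∷ zero    c z g = refl ∷ refl ∷ []
  addP-scaleP-∷ (suc n) c z g = refl ∷ addP-scaleP-∷ n c (g (suc n)) g

  mulP-linear : ∀ n c g → g (suc n) ≈ 0# →
    mulP (c ∷ 1# ∷ []) (applyDownFrom g (suc n)) ≈ₚ applyDownFrom (timesLinear c g) (suc (suc n))
  mulP-linear n c g gₙ₊₁≈0 = begin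
      mulP (c ∷ 1# ∷ []) (applyDownFrom g (suc n))
    ≈⟨ addP-cong {p = scaleP c (applyDownFrom g (suc n))} (Pointwise.refl refl) (refl ∷ mulP-identityˡ (g n) (applyDownFrom g n)) ⟩
      addP (scaleP c (applyDownFrom g (suc n))) (0# ∷ applyDownFrom g (suc n))
    ≈⟨ addP-scaleP-∷ n c 0# g ⟩
      (c * g n + 0#) ∷ applyDownFrom (timesLinear c g) (suc n)
    ≈⟨ +-congˡ (sym gₙ₊₁≈0) ∷ Pointwise.refl refl ⟩
      applyDownFrom (timesLinear c g) (suc (suc n)) ∎
    where open ≈ₚ-Reasoning

  linProd-coeffs : ∀ α → linProd α ≈ₚ applyDownFrom (λ i → sgn i * esym i α) (suc (length α))
  linProd-coeffs []      = sym (*-identityˡ 1#) ∷ []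
  linProd-coeffs (b ∷ α) = begin
      mulP (- b ∷ 1# ∷ []) (linProd α)
    ≈⟨ mulP-congʳ (- b ∷ 1# ∷ []) (linProd-coeffs α) ⟩
      mulP (- b ∷ 1# ∷ []) (applyDownFrom g (suc r))
    ≈⟨ mulP-linear r (- b) g (trans (*-congˡ (esym-vanish α (suc r) ≤-refl)) (zeroʳ _)) ⟩
      applyDownFrom (timesLinear (- b) g) (suc (suc r))
    ≈⟨ applyDownFrom⁺ (suc (suc r)) (λ i _ → timesLinear-esym i) ⟩
      applyDownFrom (λ i → sgn i * esym i (b ∷ α)) (suc (suc r)) ∎
    where
    open ≈ₚ-Reasoning
    r = length α
    g : ℕ → Carrier
    g i = sgn i * esym i α
    timesLinear-esym : ∀ i → timesLinear (- b) g i ≈ sgn i * esym i (b ∷ α)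
    timesLinear-esym zero    = refl
    timesLinear-esym (suc j) =
      trans (+-congʳ (*-congʳ (sym (-1*x≈-x b))))
            (solve 5 (λ m b′ s e₁ e₀ → m :* b′ :* (s :* e₀) :+ s :* m :* e₁ := s :* m :* (e₁ :+ b′ :* e₀))
                     refl (- 1#) b (sgn j) (esym (suc j) α) (esym j α))

  charPoly-coeffs : ∀ r σ → charPoly r σ ≡ applyDownFrom (charCoeffs σ) (suc r)
  charPoly-coeffs r σ = reverse-map-upTo (charCoeffs σ) (suc r)

  charPoly-cong : ∀ r {σ σ′ : ℕ → Carrier} → (∀ i → σ i ≈ σ′ i) → charPoly r σ ≈ₚ charPoly r σ′
  charPoly-cong r {σ} {σ′} σ≈σ′
    rewrite charPoly-coeffs r σ | charPoly-coeffs r σ′ = applyDownFrom⁺ (suc r) λ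
      { zero    _ → refl
      ; (suc i) _ → *-congˡ (σ≈σ′ (suc i)) }

  charPoly-affine : ∀ h y r σ α → length α ≡ r → charPoly r σ ≈ₚ linProd α →
    charPoly r (σbar r h y σ) ≈ₚ linProd (map (λ x → h * x + y) α)
  charPoly-affine h y .(length α) σ α ≡.refl charPoly≈linProd = begin
      charPoly r (σbar r h y σ)
    ≡⟨ charPoly-coeffs r (σbar r h y σ) ⟩
      applyDownFrom (charCoeffs (σbar r h y σ)) (suc r)
    ≈⟨ applyDownFrom⁺ (suc r) (λ i i≤r → *-congˡ (withOne-σbar≈esym i i≤r)) ⟩
      applyDownFrom (λ i → sgn i * esym i (map φ α)) (suc r)
    ≈⟨ Pointwise.symmetric sym (≡.subst (λ n → linProd (map φ α) ≈ₚ applyDownFrom (λ i → sgn i * esym i (map φ α)) (suc n))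
                                         (length-map φ α) (linProd-coeffs (map φ α))) ⟩
      linProd (map φ α) ∎
    where
    open ≈ₚ-Reasoning
    r = length α
    φ : Carrier → Carrier
    φ x = h * x + y
    withOne≈esym : ∀ i → i < suc r → withOne σ i ≈ esym i α
    withOne≈esym i (s≤s i≤r) = sgn-cancelˡ i (applyDownFrom⁻ (suc r) coeffs≈ i (s≤s i≤r))
      where
      coeffs≈ : applyDownFrom (charCoeffs σ) (suc r) ≈ₚ applyDownFrom (λ i → sgn i * esym i α) (suc r)
      coeffs≈ = ≡.subst (_≈ₚ _) (charPoly-coeffs r σ) (Pointwise.transitive trans charPoly≈linProd (linProd-coeffs α))
    withOne-σbar≈esym : ∀ i → i < suc r → withOne (σbar r h y σ) i ≈ esym i (map φ α)
    withOne-σbar≈esym i (s≤s i≤r) =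
      trans (withOne-σbar r h y σ i)
            (trans (affineSym-cong h y r i (λ k k≤i → withOne≈esym k (s≤s (≤-trans k≤i i≤r))))
                   (sym (esym-affine h y α i)))

module Homomorphism {c ℓ c′ ℓ′ : Level} (R : CommutativeRing c ℓ) (F : CommutativeRing c′ ℓ′)
  {ι : CommutativeRing.Carrier R → CommutativeRing.Carrier F}
  (isHom : RingMorphisms.IsRingHomomorphism (CommutativeRing.rawRing R) (CommutativeRing.rawRing F) ι) where
  private module R = CR R
  open CommutativeRing F
  open CR F
  open RingMorphisms.IsRingHomomorphism isHom
  open Sums F

  ι-sumTo : ∀ n f → ι (R.sumTo n f) ≈ sumTo n (ι ∘ f)
  ι-sumTo zero    f = 0#-homo
  ι-sumTo (suc n) f = trans (+-homo _ _) (+-congʳ (ι-sumTo n f))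

  ι-nat : ∀ n → ι (R.nat n) ≈ nat n
  ι-nat zero    = 0#-homo
  ι-nat (suc n) = trans (+-homo _ _) (+-cong 1#-homo (ι-nat n))

  ι-pow : ∀ x n → ι (R.pow x n) ≈ pow (ι x) n
  ι-pow x zero    = 1#-homo
  ι-pow x (suc n) = trans (*-homo _ _) (*-congʳ (ι-pow x n))

  ι-withOne : ∀ σ k → ι (R.withOne σ k) ≈ withOne (ι ∘ σ) k
  ι-withOne σ zero    = 1#-homo
  ι-withOne σ (suc k) = refl

  ι-σbar : ∀ r h y σ i → ι (R.σbar r h y σ i) ≈ σbar r (ι h) (ι y) (ι ∘ σ) i
  ι-σbar r h y σ i = trans (ι-sumTo (suc i) _) (sumTo-cong (suc i) λ k _ →
    trans (*-homo _ _) (*-cong (trans (*-homo _ _) (*-cong (trans (*-homo _ _)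
      (*-cong (ι-nat ((r ∸ k) C (i ∸ k))) (ι-pow h k))) (ι-pow y (i ∸ k)))) (ι-withOne σ k)))

theorem4 : ∀ {c ℓ c′ ℓ′} (R : CommutativeRing c ℓ) → CR.IsIntegralDomain R →
    (h y : CommutativeRing.Carrier R) → CR.IsNonzero R h → CR.IsNonzero R y →
    (r : ℕ) (σ : ℕ → CommutativeRing.Carrier R) (a : ℕ → CommutativeRing.Carrier R) →
    CR.IsLinRec R r (CR.recCoeffs R σ) a →
    CR.IsLinRec R r (CR.recCoeffs R (CR.σbar R r h y σ)) (CR.L R h y a)
    × ((F : CommutativeRing c′ ℓ′) → CR.IsField F →
       (ι : CommutativeRing.Carrier R → CommutativeRing.Carrier F) →
       RingMorphisms.IsRingMonomorphism (CommutativeRing.rawRing R) (CommutativeRing.rawRing F) ι →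
       (α : List (CommutativeRing.Carrier F)) → length α ≡ r →
       CR._≈ₚ_ F (CR.charPoly F r (λ i → ι (σ i))) (CR.linProd F α) →
       CR._≈ₚ_ F (CR.charPoly F r (λ i → ι (CR.σbar R r h y σ i)))
         (CR.linProd F (map (λ x → CommutativeRing._+_ F (CommutativeRing._*_ F (ι h) x) (ι y)) α)))
theorem4 R _ h y _ _ r σ a rec =
  Recurrences.L-isLinRec R h y r σ a rec ,
  λ F _ ι mono α |α|≡r charPoly≈linProd →
    Pointwise.transitive (CommutativeRing.trans F)
      (Polynomials.charPoly-cong F r
        (Homomorphism.ι-σbar R F (RingMorphisms.IsRingMonomorphism.isRingHomomorphism mono) r h y σ))
      (Polynomials.charPoly-affine F (ι h) (ι y) r (ι ∘ σ) α |α|≡r charPoly≈linProd)
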